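{- Suppose $n\ge 7$ and $2<k<\frac{n}{2}$. Let $F$ be a facet of ${\tt vdW}(n,k)$ whose increment $d$ is the largest increment of any facet of ${\tt vdW}(n,k)$. If $G$ is any other facet of ${\tt vdW}(n,k)$ with increment $d'\ne d$, then $|F\cap G|\le k-1$.
   Context: Let $V=\{x_1,\ldots,x_n\}$ and $0<k<n$. The van der Waerden complex ${\tt vdW}(n,k)$ is the simplicial complex on $V$ whose facets are exactly the sets $\{x_i,x_{i+d},x_{i+2d},\ldots,x_{i+kd}\}$ for integers $d$ and $i$ with $1\le i<i+kd\le n$ (so $d\ge1$). For such a facet, the integer $d$ is called its increment. -}

module Defs where

open import Data.Nat using (ℕ; zero; suc; _+_; _*_; _∸_; _≤_; _<_)
open import Data.Nat.Properties using (_≟_)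
open import Data.List using (List; map; filter; length; upTo; applyUpTo)

open import Data.List.Membership.DecPropositional _≟_ using (_∈?_)
open import Relation.Nullary.Decidable using (_×-dec_)


-- Vertices x_1,...,x_n are represented by the natural numbers 1,...,n.

-- A facet of vdW(n,k) is given by a start index i and an increment d with
-- 1 ≤ i, 1 ≤ d and i + k*d ≤ n.
record IsFacetData (n k i d : ℕ) : Set where
  field
    start≥1 : 1 ≤ i
    incr≥1  : 1 ≤ d
    fits    : i + k * d ≤ n

facetVerts : (k i d : ℕ) → List ℕ
facetVerts k i d = map (λ j → i + j * d) (upTo (suc k))

vertices : ℕ → List ℕ
vertices n = applyUpTo suc n

intersectionSize : (n k i d i' d' : ℕ) → ℕ
intersectionSize n k i d i' d' =
  length (filter (λ x → (x ∈? facetVerts k i d) ×-dec (x ∈? facetVerts k i' d'))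
                 (vertices n))

-- Call a position j ∈ {0,…,k} of F = {i + j d} a hit if i + j d ∈ G.
-- If at least k of the k + 1 positions were hits, there would be two
-- consecutive hits and two hits at distance t ≥ k − 1. Consecutive hits make
-- d a multiple c d' of d', with c ≥ 2 as d' ≠ d; distant hits give
-- t c d' = t d ≤ k d', since G spans k d'. Hence 2(k − 1) ≤ k, impossible for
-- k ≥ 3.

module Submission where

open import Defs
open import Data.Nat using (ℕ; _+_; _*_; _∸_; _≤_; _<_)
open import Relation.Nullary using (¬_)
open import Relation.Binary.PropositionalEquality using (_≡_)

open import Data.Nat using (zero; suc; z≤n; s≤s; s≤s⁻¹)
open import Data.Nat.Properties
open import Data.List using (List; []; _∷_; _++_; map; filter; length; upTo)
open import Data.List.Properties using (length-map; length-upTo; length-++-sucʳ)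
open import Data.List.Membership.Propositional using (_∈_)
open import Data.List.Membership.Propositional.Properties
open import Data.List.Membership.DecPropositional _≟_ using (_∈?_)
open import Data.List.Relation.Binary.Subset.Propositional using (_⊆_)
open import Data.List.Relation.Unary.Any using (here; there)
open import Data.List.Relation.Unary.All using (All; _∷_; tabulate) renaming (lookup to All-lookup)
open import Data.List.Relation.Unary.AllPairs using (_∷_)
open import Data.List.Relation.Unary.Unique.Propositional using (Unique)
import Data.List.Relation.Unary.Unique.Propositional.Properties as Unique
open import Data.Product using (∃₂; ∃-syntax; _×_; _,_; proj₁; proj₂)
open import Data.Sum using (inj₁; inj₂)
open import Relation.Nullary using (yes; no; contradiction; _×-dec_)
open import Function using (_∘′_)
open import Relation.Unary using (Pred; Decidable)
open import Relation.Binary.PropositionalEquality using (refl; sym; trans; cong; subst; _≢_; module ≡-Reasoning)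
open import Level using (Level)

private
  variable
    ℓ : Level
    A : Set ℓ

Unique-⊆⇒length≤ : {xs ys : List A} → Unique xs → xs ⊆ ys → length xs ≤ length ys
Unique-⊆⇒length≤ {xs = []} _ _ = z≤n
Unique-⊆⇒length≤ {xs = x ∷ xs} {ys} (x∉xs ∷ unique-xs) xs⊆ys
  with us , vs , refl ← ∈-∃++ (xs⊆ys (here refl)) =
  subst (_ ≤_) (sym (length-++-sucʳ us x vs)) (s≤s (Unique-⊆⇒length≤ unique-xs xs⊆us++vs))
  where
  xs⊆us++vs : xs ⊆ us ++ vs
  xs⊆us++vs {y} y∈xs with ∈-++⁻ us (xs⊆ys (there y∈xs))
  ... | inj₁ y∈us        = ∈-++⁺ˡ y∈us
  ... | inj₂ (here y≡x)  = contradiction (sym y≡x) (All-lookup x∉xs y∈xs)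
  ... | inj₂ (there y∈vs) = ∈-++⁺ʳ us y∈vs

length-filter-two-rejected : {P : Pred A ℓ} (P? : Decidable P) {xs : List A} {a b : A} →
  Unique xs → a ∈ xs → b ∈ xs → a ≢ b → ¬ P a → ¬ P b →
  2 + length (filter P? xs) ≤ length xs
length-filter-two-rejected {P = P} P? {xs} {a} {b} unique-xs a∈xs b∈xs a≢b ¬Pa ¬Pb =
  Unique-⊆⇒length≤ ((a≢b ∷ not-accepted ¬Pa) ∷ not-accepted ¬Pb ∷ Unique.filter⁺ P? unique-xs) sub
  where
  not-accepted : ∀ {z} → ¬ P z → All (z ≢_) (filter P? xs)
  not-accepted ¬Pz = tabulate λ y∈ → λ { refl → ¬Pz (proj₂ (∈-filter⁻ P? {xs = xs} y∈)) }
  sub : a ∷ b ∷ filter P? xs ⊆ xs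
  sub (here refl)         = a∈xs
  sub (there (here refl)) = b∈xs
  sub (there (there y∈))  = proj₁ (∈-filter⁻ P? {xs = xs} y∈)

gap-in-facet : ∀ {k i d x s} → x ∈ facetVerts k i d → x + s ∈ facetVerts k i d →
  ∃[ c ] c ≤ k × s ≡ c * d
gap-in-facet {k} {i} {d} {x} {s} x∈ x+s∈
  with a , _   , refl ← ∈-map⁻ (λ j → i + j * d) {xs = upTo (suc k)} x∈
     | b , b∈ , x+s≡ ← ∈-map⁻ (λ j → i + j * d) {xs = upTo (suc k)} x+s∈ =
  b ∸ a , ≤-trans (m∸n≤m b a) (s≤s⁻¹ (∈-upTo⁻ b∈)) , s≡
  where
  open ≡-Reasoning
  s≡ : s ≡ (b ∸ a) * d
  s≡ = begin
    s                         ≡⟨ sym (m+n∸m≡n x s) ⟩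
    x + s ∸ x                 ≡⟨ cong (_∸ x) x+s≡ ⟩
    (i + b * d) ∸ (i + a * d) ≡⟨ [m+n]∸[m+o]≡n∸o i (b * d) (a * d) ⟩
    b * d ∸ a * d             ≡⟨ sym (*-distribʳ-∸ d b a) ⟩
    (b ∸ a) * d               ∎

MissesAtMostOne : Pred ℕ ℓ → ℕ → Set ℓ
MissesAtMostOne Q k = ∀ {a b} → a ≤ k → b ≤ k → a ≢ b → ¬ Q a → Q b

module Positions {Q : Pred ℕ ℓ} (Q? : Decidable Q) where

  hits : ℕ → ℕ
  hits k = length (filter Q? (upTo (suc k)))

  missesAtMostOne : ∀ {k} → k ∸ 1 < hits k → MissesAtMostOne Q k
  missesAtMostOne {k} many {_} {b} a≤k b≤k a≢b ¬Qa with Q? b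
  ... | yes Qb = Qb
  ... | no ¬Qb = contradiction (≤-trans two-misses (s≤s (≤-trans (m≤n+m∸n k 1) many))) 1+n≰n
    where
    two-misses : 2 + hits k ≤ suc k
    two-misses = subst (2 + hits k ≤_) (length-upTo (suc k))
      (length-filter-two-rejected Q? (Unique.upTo⁺ (suc k))
        (∈-upTo⁺ (s≤s a≤k)) (∈-upTo⁺ (s≤s b≤k)) a≢b ¬Qa ¬Qb)

  consecutive-hits : ∀ {k} → 3 ≤ k → MissesAtMostOne Q k → ∃[ j ] Q j × Q (j + 1)
  consecutive-hits 3≤k miss with Q? 1 | Q? 2
  ... | yes Q1 | yes Q2 = 1 , Q1 , Q2
  ... | yes Q1 | no ¬Q2 = 0 , miss (<⇒≤ 3≤k) z≤n (λ ()) ¬Q2 , Q1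
  ... | no ¬Q1 | _      = 2 , miss 1≤k (<⇒≤ 3≤k) (λ ()) ¬Q1 , miss 1≤k 3≤k (λ ()) ¬Q1
    where
    1≤k : 1 ≤ _
    1≤k = <⇒≤ (<⇒≤ 3≤k)

  distant-hits : ∀ {k} → 1 ≤ k → MissesAtMostOne Q k →
    ∃₂ λ j t → k ∸ 1 ≤ t × Q j × Q (j + t)
  distant-hits {suc m} _ miss with Q? 0 | Q? (suc m)
  ... | yes Q0 | yes Qk = 0 , suc m , n≤1+n m , Q0 , Qk
  ... | yes Q0 | no ¬Qk = 0 , m , ≤-refl , Q0 , miss ≤-refl (n≤1+n m) 1+n≢n ¬Qk
  ... | no ¬Q0 | _      = 1 , m , ≤-refl , miss z≤n (s≤s z≤n) (λ ()) ¬Q0 , miss z≤n ≤-refl (λ ()) ¬Q0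

intersectionSize≤hits : ∀ n k i d i' d' →
  intersectionSize n k i d i' d' ≤ Positions.hits (λ j → i + j * d ∈? facetVerts k i' d') k
intersectionSize≤hits n k i d i' d' =
  subst (intersectionSize n k i d i' d' ≤_) (length-map (λ j → i + j * d) (filter Q? (upTo (suc k))))
    (Unique-⊆⇒length≤ (Unique.filter⁺ P? vertices-unique) common⊆hit-vertices)
  where
  Q? = λ j → i + j * d ∈? facetVerts k i' d'
  P? = λ x → (x ∈? facetVerts k i d) ×-dec (x ∈? facetVerts k i' d')
  vertices-unique : Unique (vertices n)
  vertices-unique = Unique.applyUpTo⁺₁ suc n (λ i<j _ → <⇒≢ i<j ∘′ suc-injective)
  common⊆hit-vertices : filter P? (vertices n) ⊆ map (λ j → i + j * d) (filter Q? (upTo (suc k)))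
  common⊆hit-vertices x∈ with _ , x∈F , x∈G ← ∈-filter⁻ P? {xs = vertices n} x∈
                         with j , j∈ , refl ← ∈-map⁻ (λ j → i + j * d) {xs = upTo (suc k)} x∈F =
    ∈-map⁺ (λ j → i + j * d) (∈-filter⁺ Q? j∈ x∈G)

hit-gap : ∀ {k i d i' d' j t} →
  i + j * d ∈ facetVerts k i' d' → i + (j + t) * d ∈ facetVerts k i' d' →
  ∃[ e ] e ≤ k × t * d ≡ e * d'
hit-gap {k} {i} {d} {i'} {d'} {j} {t} hit-j hit-j+t =
  gap-in-facet hit-j (subst (_∈ facetVerts k i' d') shift hit-j+t)
  where
  shift : i + (j + t) * d ≡ i + j * d + t * d
  shift = trans (cong (i +_) (*-distribʳ-+ d j t)) (sym (+-assoc i (j * d) (t * d)))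

multiple-of-other-increment : ∀ {c d d'} → 1 ≤ d → d' ≢ d → d ≡ c * d' → 2 ≤ c
multiple-of-other-increment {zero}                  1≤d _    refl  = contradiction 1≤d (λ ())
multiple-of-other-increment {suc zero} {d' = d'}     _   d'≢d d≡d'  =
  contradiction (sym (trans d≡d' (+-identityʳ d'))) d'≢d
multiple-of-other-increment {suc (suc _)}            _   _    _     = s≤s (s≤s z≤n)

gap-multiplier-bound : ∀ {c d d' e k t} → 1 ≤ d' → d ≡ c * d' → t * d ≡ e * d' → e ≤ k → t * c ≤ k
gap-multiplier-bound {c} {d} {d'@(suc _)} {e} {k} {t} _ d≡c*d' t*d≡e*d' e≤k =
  *-cancelʳ-≤ (t * c) k d' (begin
    t * c * d'   ≡⟨ *-assoc t c d' ⟩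
    t * (c * d') ≡⟨ cong (t *_) (sym d≡c*d') ⟩
    t * d        ≡⟨ t*d≡e*d' ⟩
    e * d'       ≤⟨ *-monoˡ-≤ d' e≤k ⟩
    k * d'       ∎)
  where open ≤-Reasoning

double-gap-exceeds : ∀ {k t} → 3 ≤ k → k ∸ 1 ≤ t → ¬ t * 2 ≤ k
double-gap-exceeds {k} {t} 3≤k k∸1≤t t*2≤k =
  contradiction (≤-trans 3≤k (≤-trans k≤1+t (s≤s t≤1))) (λ { (s≤s (s≤s ())) })
  where
  k≤1+t : k ≤ 1 + t
  k≤1+t = ≤-trans (m≤n+m∸n k 1) (+-monoʳ-≤ 1 k∸1≤t)
  t≤1 : t ≤ 1
  t≤1 = +-cancelˡ-≤ t t 1 (begin
    t + t      ≡⟨ cong (t +_) (sym (+-identityʳ t)) ⟩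
    2 * t      ≡⟨ *-comm 2 t ⟩
    t * 2      ≤⟨ t*2≤k ⟩
    k          ≤⟨ k≤1+t ⟩
    1 + t      ≡⟨ +-comm 1 t ⟩
    t + 1      ∎)
    where open ≤-Reasoning

lemma3p2 : (n k : ℕ) → 7 ≤ n → 2 < k → 2 * k < n →
    (i d : ℕ) → IsFacetData n k i d →
    ((i₀ d₀ : ℕ) → IsFacetData n k i₀ d₀ → d₀ ≤ d) →
    (i' d' : ℕ) → IsFacetData n k i' d' → ¬ (d' ≡ d) →
    intersectionSize n k i d i' d' ≤ k ∸ 1
lemma3p2 n k _ 3≤k _ i d F _ i' d' G d'≢d =
  ≤-trans (intersectionSize≤hits n k i d i' d') (≮⇒≥ few-hits)
  where
  open IsFacetData
  open Positions (λ j → i + j * d ∈? facetVerts k i' d')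
  few-hits : ¬ k ∸ 1 < hits k
  few-hits many
    with miss ← missesAtMostOne many
    with j , hit-j , hit-j+1 ← consecutive-hits 3≤k miss
       | j' , t , k∸1≤t , hit-j' , hit-j'+t ← distant-hits (≤-trans (s≤s z≤n) 3≤k) miss
    with c , _ , 1*d≡c*d' ← hit-gap {j = j} {t = 1} hit-j hit-j+1
       | e , e≤k , t*d≡e*d' ← hit-gap {j = j'} {t = t} hit-j' hit-j'+t =
    double-gap-exceeds 3≤k k∸1≤t (≤-trans (*-monoʳ-≤ t 2≤c) t*c≤k)
    where
    d≡c*d' : d ≡ c * d'
    d≡c*d' = trans (sym (*-identityˡ d)) 1*d≡c*d'
    2≤c : 2 ≤ c
    2≤c = multiple-of-other-increment (incr≥1 F) d'≢d d≡c*d'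
    t*c≤k : t * c ≤ k
    t*c≤k = gap-multiplier-bound {c = c} {t = t} (incr≥1 G) d≡c*d' t*d≡e*d' e≤k
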